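{- Let $R$ be a commutative ring and let $G_1,G_2$ be connected edge labeled graphs over $R$, each satisfying the Universal Difference Property, with $V(G_1)\cap V(G_2)=\{z\}$. Let $G=G_1\cup G_2$ be the graph obtained by pasting $G_1$ and $G_2$ at $z$, with edge labeling $\alpha$ restricting to the given labelings. Suppose that for every $u,w\in V(G)$, either $$\bigcap_{P\in\mathcal{P}_{(u,w)}}\alpha(P)\subseteq\bigcap_{P\in\mathcal{P}_{(u,z)}}\alpha(P)\quad\text{or}\quad\bigcap_{P\in\mathcal{P}_{(u,w)}}\alpha(P)\subseteq\bigcap_{P\in\mathcal{P}_{(w,z)}}\alpha(P),$$ where all paths are taken in $G$. Then $(G,\alpha)$ satisfies the Universal Difference Property.
   Context: Graphs are finite. An edge labeling of a graph $G=(V,E)$ over a commutative ring $R$ is a function $\alpha:E\to\mathcal{I}(R)$ assigning to each edge an ideal of $R$. A (generalized) spline on $(G,\alpha)$ is a function $\rho:V\to R$ such that for each edge $ab$, $\rho(a)-\rho(b)\in\alpha(ab)$. For vertices $u,w$, $\mathcal{P}_{(u,w)}$ denotes the set of all paths from $u$ to $w$, and for a path $P$ with edges $e_1,\dots,e_k$, $\alpha(P)=\alpha(e_1)+\cdots+\alpha(e_k)$. An edge labeled graph satisfies the Universal Difference Property (UDP) if for every pair of vertices $u,w$ connected by a path and every $x\in\bigcap_{P\in\mathcal{P}_{(u,w)}}\alpha(P)$ there exists a spline $\rho$ with $\rho(u)-\rho(w)=x$. -}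

module Defs where

open import Level using (Level; _⊔_) renaming (suc to lsuc; zero to lzero)
open import Algebra.Bundles using (CommutativeRing)
open import Data.Nat using (ℕ)
open import Data.Fin using (Fin)
open import Data.Product using (Σ; _×_; _,_; ∃; ∃-syntax)
open import Data.Sum using (_⊎_)
open import Data.List using (List; []; _∷_)
open import Data.List.Relation.Unary.Unique.Propositional using (Unique)
open import Relation.Binary.PropositionalEquality using (_≡_; _≢_)
open import Relation.Nullary using (¬_)
open import Data.Unit using (⊤)

record Ideal {c ℓ} (R : CommutativeRing c ℓ) : Set (c ⊔ lsuc ℓ) where
  open CommutativeRing R
  field
    _∈I     : Carrier → Set ℓ
    ∈-resp  : ∀ {x y} → x ≈ y → x ∈I → y ∈I
    0∈      : 0# ∈I
    +-closed : ∀ {x y} → x ∈I → y ∈I → (x + y) ∈I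
    *-closed : ∀ r {x} → x ∈I → (r * x) ∈I

-- Finite simple graphs: vertices Fin n, edges Fin m, each edge an
-- unordered pair {src e , tgt e} of distinct vertices, no parallel edges.

record Graph : Set where
  field
    nV : ℕ
    nE : ℕ
    src tgt : Fin nE → Fin nV
    noLoop : ∀ e → src e ≢ tgt e
    noParallel : ∀ e f →
      ((src e ≡ src f × tgt e ≡ tgt f) ⊎ (src e ≡ tgt f × tgt e ≡ src f)) →
      e ≡ f

module _ (G : Graph) where
  open Graph G

  Joins : Fin nE → Fin nV → Fin nV → Set
  Joins e u v = (src e ≡ u × tgt e ≡ v) ⊎ (src e ≡ v × tgt e ≡ u)

  -- A subgraph given by a vertex set VS and an edge set ES
  -- (it is assumed separately that edges of ES have their ends in VS).
  -- Walks in the subgraph (VS , ES) from u to w.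
  data Walk (VS : Fin nV → Set) (ES : Fin nE → Set) : Fin nV → Fin nV → Set where
    nil  : ∀ {u} → VS u → Walk VS ES u u
    cons : ∀ {u v w} (e : Fin nE) → VS u → ES e → Joins e u v →
           Walk VS ES v w → Walk VS ES u w

  verts : ∀ {VS ES u w} → Walk VS ES u w → List (Fin nV)
  verts (nil {u} _) = u ∷ []
  verts (cons {u} _ _ _ _ p) = u ∷ verts p

  record Path (VS : Fin nV → Set) (ES : Fin nE → Set) (u w : Fin nV) : Set where
    constructor mkPath
    field
      walk     : Walk VS ES u w
      distinct : Unique (verts walk)

  AllV : Fin nV → Set
  AllV _ = ⊤
  AllE : Fin nE → Set
  AllE _ = ⊤

  Connected : (Fin nV → Set) → (Fin nE → Set) → Set
  Connected VS ES = ∀ u w → VS u → VS w → Path VS ES u w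

  module _ {c ℓ} (R : CommutativeRing c ℓ) (α : Fin nE → Ideal R) where
    open CommutativeRing R

    -- membership in α(P) = α(e₁) + ⋯ + α(eₖ)  (sum of ideals; empty sum = 0)
    InSum : ∀ {VS ES u w} → Walk VS ES u w → Carrier → Set (c ⊔ ℓ)
    InSum (nil _) x = Level.Lift c (x ≈ 0#)
    InSum (cons e _ _ _ p) x =
      ∃[ a ] ∃[ b ] (Ideal._∈I (α e) a × InSum p b × x ≈ a + b)

    InAllPaths : (Fin nV → Set) → (Fin nE → Set) → Fin nV → Fin nV → Carrier → Set (c ⊔ ℓ)
    InAllPaths VS ES u w x = ∀ (P : Path VS ES u w) → InSum (Path.walk P) x

    -- generalized spline on the subgraph (VS , ES) with labeling α
    -- (values at vertices outside VS play no role)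
    IsSpline : (Fin nE → Set) → (Fin nV → Carrier) → Set ℓ
    IsSpline ES ρ = ∀ e → ES e → Ideal._∈I (α e) (ρ (src e) - ρ (tgt e))

    UDP : (Fin nV → Set) → (Fin nE → Set) → Set (c ⊔ ℓ)
    UDP VS ES = ∀ u w → VS u → VS w → Path VS ES u w →
                ∀ x → InAllPaths VS ES u w x →
                Σ (Fin nV → Carrier) λ ρ → IsSpline ES ρ × (ρ u - ρ w ≈ x)

-- A vertex pair inside one half G₁ is handled by the UDP of G₁: its spline
-- is extended to G by the constant value at z on G₂, which is a spline since
-- every edge of G₂ then has difference 0. For u ∈ G₁ and w ∈ G₂ the
-- hypothesis moves x into ⋂ α(P) over paths u–z (or w–z); the half containing
-- that pair yields a spline constant on the other half, so ρ(u) - ρ(w) is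
-- ρ(u) - ρ(z) (or ρ(z) - ρ(w)). Path intersections in G only shrink when
-- restricted to a half, since every path of a half is a path of G.
module Submission where

open import Defs
open import Algebra.Bundles using (CommutativeRing)
open import Data.Fin using (Fin)
open import Data.Product using (_×_)
open import Data.Sum using (_⊎_)
open import Relation.Binary.PropositionalEquality using (_≡_)

open import Level using (0ℓ; _⊔_; lift) renaming (suc to lsuc)
open import Data.Product using (Σ; _,_; proj₁; proj₂)
open import Data.Sum using (inj₁; inj₂; [_,_]) renaming (swap to ⊎-swap)
open import Data.Unit using (tt)
open import Data.List using (_∷_)
open import Data.List.Relation.Unary.Unique.Propositional using (Unique)
import Relation.Binary.PropositionalEquality as ≡
import Algebra.Properties.Ring as RingProperties
import Relation.Binary.Reasoning.Setoid as SetoidReasoning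

module _ (G : Graph) where
  open Graph G

  embed : ∀ {VS ES u w} → Walk G VS ES u w → Walk G (AllV G) (AllE G) u w
  embed (nil _)          = nil tt
  embed (cons e _ _ j p) = cons e tt tt j (embed p)

  verts-embed : ∀ {VS ES u w} (p : Walk G VS ES u w) → verts G (embed p) ≡ verts G p
  verts-embed (nil _)               = ≡.refl
  verts-embed (cons {u} _ _ _ _ p)  = ≡.cong (u ∷_) (verts-embed p)

  embedPath : ∀ {VS ES u w} → Path G VS ES u w → Path G (AllV G) (AllE G) u w
  embedPath (mkPath p distinct) =
    mkPath (embed p) (≡.subst Unique (≡.sym (verts-embed p)) distinct)

  module _ {c ℓ} (R : CommutativeRing c ℓ) (α : Fin nE → Ideal R) where
    open CommutativeRing R
    open RingProperties ring using (-‿+-comm; -1*x≈-x; -0#≈0#)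
    module α e = Ideal (α e)

    InSum-embed : ∀ {VS ES u w} (p : Walk G VS ES u w) {x} →
      InSum G R α (embed p) x → InSum G R α p x
    InSum-embed (nil _)          x≈0                      = x≈0
    InSum-embed (cons _ _ _ _ p) (a , b , a∈ , b∈ , x≈a+b) =
      a , b , a∈ , InSum-embed p b∈ , x≈a+b

    InAllPaths-restrict : ∀ VS ES {u w x} →
      InAllPaths G R α (AllV G) (AllE G) u w x → InAllPaths G R α VS ES u w x
    InAllPaths-restrict VS ES x∈ P = InSum-embed (Path.walk P) (x∈ (embedPath P))

    InSum-neg : ∀ {VS ES u w} (p : Walk G VS ES u w) {x} →
      InSum G R α p x → InSum G R α p (- x)
    InSum-neg (nil _)            (lift x≈0)              = lift (trans (-‿cong x≈0) -0#≈0#)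
    InSum-neg (cons e _ _ _ p) (a , b , a∈ , b∈ , x≈a+b) =
      - a , - b , α.∈-resp e (-1*x≈-x a) (α.*-closed e (- 1#) a∈) ,
      InSum-neg p b∈ , trans (-‿cong x≈a+b) (sym (-‿+-comm a b))

    InAllPaths-neg : ∀ VS ES {u w x} →
      InAllPaths G R α VS ES u w x → InAllPaths G R α VS ES u w (- x)
    InAllPaths-neg VS ES x∈ P = InSum-neg (Path.walk P) (x∈ P)

    InAll : Fin nV → Fin nV → Carrier → Set (c ⊔ ℓ)
    InAll = InAllPaths G R α (AllV G) (AllE G)

    record Pasting : Set (lsuc 0ℓ ⊔ c ⊔ ℓ) where
      field
        V₁ V₂       : Fin nV → Set
        E₁ E₂       : Fin nE → Set
        z           : Fin nV
        z∈V₁        : V₁ z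
        z∈V₂        : V₂ z
        V₁∩V₂⊆z     : ∀ v → V₁ v → V₂ v → v ≡ z
        V₁∪V₂       : ∀ v → V₁ v ⊎ V₂ v
        E₁-ends     : ∀ e → E₁ e → V₁ (src e) × V₁ (tgt e)
        E₂-ends     : ∀ e → E₂ e → V₂ (src e) × V₂ (tgt e)
        E₁∪E₂       : ∀ e → E₁ e ⊎ E₂ e
        connected₁  : Connected G V₁ E₁
        connected₂  : Connected G V₂ E₂
        udp₁        : UDP G R α V₁ E₁
        udp₂        : UDP G R α V₂ E₂

    swap : Pasting → Pasting
    swap W = record
      { V₁ = V₂ ; V₂ = V₁ ; E₁ = E₂ ; E₂ = E₁ ; z = z
      ; z∈V₁ = z∈V₂ ; z∈V₂ = z∈V₁
      ; V₁∩V₂⊆z = λ v v∈V₂ v∈V₁ → V₁∩V₂⊆z v v∈V₁ v∈V₂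
      ; V₁∪V₂ = λ v → ⊎-swap (V₁∪V₂ v)
      ; E₁-ends = E₂-ends ; E₂-ends = E₁-ends
      ; E₁∪E₂ = λ e → ⊎-swap (E₁∪E₂ e)
      ; connected₁ = connected₂ ; connected₂ = connected₁
      ; udp₁ = udp₂ ; udp₂ = udp₁
      }
      where open Pasting W

    module OnFirstHalf (W : Pasting) where
      open Pasting W

      extend : (Fin nV → Carrier) → Fin nV → Carrier
      extend ρ v = [ (λ _ → ρ v) , (λ _ → ρ z) ] (V₁∪V₂ v)

      extend-V₁ : ∀ ρ {v} → V₁ v → extend ρ v ≈ ρ v
      extend-V₁ ρ {v} v∈V₁ with V₁∪V₂ v
      ... | inj₁ _     = refl
      ... | inj₂ v∈V₂ = reflexive (≡.cong ρ (≡.sym (V₁∩V₂⊆z v v∈V₁ v∈V₂)))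

      extend-V₂ : ∀ ρ {v} → V₂ v → extend ρ v ≈ ρ z
      extend-V₂ ρ {v} v∈V₂ with V₁∪V₂ v
      ... | inj₁ v∈V₁ = reflexive (≡.cong ρ (V₁∩V₂⊆z v v∈V₁ v∈V₂))
      ... | inj₂ _     = refl

      extend-constantOnV₂ : ∀ ρ {v} → V₂ v → extend ρ v ≈ extend ρ z
      extend-constantOnV₂ ρ v∈V₂ = trans (extend-V₂ ρ v∈V₂) (sym (extend-V₁ ρ z∈V₁))

      extend-isSpline : ∀ ρ → IsSpline G R α E₁ ρ → IsSpline G R α (AllE G) (extend ρ)
      extend-isSpline ρ spline e _ with E₁∪E₂ e
      ... | inj₁ e∈E₁ with E₁-ends e e∈E₁
      ...   | s∈V₁ , t∈V₁ = α.∈-resp e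
        (sym (+-cong (extend-V₁ ρ s∈V₁) (-‿cong (extend-V₁ ρ t∈V₁))))
        (spline e e∈E₁)
      extend-isSpline ρ spline e _ | inj₂ e∈E₂ with E₂-ends e e∈E₂
      ...   | s∈V₂ , t∈V₂ = α.∈-resp e
        (sym (trans (+-cong (extend-V₂ ρ s∈V₂) (-‿cong (extend-V₂ ρ t∈V₂))) (-‿inverseʳ (ρ z))))
        (α.0∈ e)

      udp-constantOnV₂ : ∀ {a b x} → V₁ a → V₁ b → InAll a b x →
        Σ (Fin nV → Carrier) λ ρ →
          IsSpline G R α (AllE G) ρ × (ρ a - ρ b ≈ x) × (∀ v → V₂ v → ρ v ≈ ρ z)
      udp-constantOnV₂ {a} {b} {x} a∈V₁ b∈V₁ x∈ =
          extend ρ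
        , extend-isSpline ρ spline
        , trans (+-cong (extend-V₁ ρ a∈V₁) (-‿cong (extend-V₁ ρ b∈V₁))) ρa-ρb≈x
        , λ _ → extend-constantOnV₂ ρ
        where
        udp : Σ (Fin nV → Carrier) λ ρ → IsSpline G R α E₁ ρ × (ρ a - ρ b ≈ x)
        udp = udp₁ a b a∈V₁ b∈V₁ (connected₁ a b a∈V₁ b∈V₁) x
                   (InAllPaths-restrict V₁ E₁ x∈)
        ρ : Fin nV → Carrier
        ρ = proj₁ udp
        spline : IsSpline G R α E₁ ρ
        spline = proj₁ (proj₂ udp)
        ρa-ρb≈x : ρ a - ρ b ≈ x
        ρa-ρb≈x = proj₂ (proj₂ udp)

    open OnFirstHalf using (udp-constantOnV₂)
    open RingProperties ring using (-‿involutive; ⁻¹-anti-homo‿-)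
    open SetoidReasoning setoid

    udp-across : (W : Pasting) → let open Pasting W in
      ∀ {u w x} → V₁ u → V₂ w →
      ((∀ y → InAll u w y → InAll u z y) ⊎ (∀ y → InAll u w y → InAll w z y)) →
      InAll u w x →
      Σ (Fin nV → Carrier) λ ρ → IsSpline G R α (AllE G) ρ × (ρ u - ρ w ≈ x)
    udp-across W {u} {w} {x} u∈V₁ w∈V₂ (inj₁ toUZ) x∈ =
      let (ρ , spline , ρu-ρz≈x , constant) = udp-constantOnV₂ W u∈V₁ z∈V₁ (toUZ x x∈)
      in ρ , spline , trans (+-congˡ (-‿cong (constant w w∈V₂))) ρu-ρz≈x
      where open Pasting W
    udp-across W {u} {w} {x} u∈V₁ w∈V₂ (inj₂ toWZ) x∈ =
      let (ρ , spline , ρw-ρz≈-x , constant) =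
            udp-constantOnV₂ (swap W) w∈V₂ z∈V₂ (InAllPaths-neg (AllV G) (AllE G) (toWZ x x∈))
      in ρ , spline , (begin
        ρ u - ρ w     ≈⟨ +-congʳ (constant u u∈V₁) ⟩
        ρ z - ρ w     ≈⟨ ⁻¹-anti-homo‿- (ρ w) (ρ z) ⟨
        - (ρ w - ρ z) ≈⟨ -‿cong ρw-ρz≈-x ⟩
        - - x         ≈⟨ -‿involutive x ⟩
        x             ∎)
      where open Pasting W

    udp-pasting : (W : Pasting) → let open Pasting W in
      (∀ u w → (∀ y → InAll u w y → InAll u z y) ⊎ (∀ y → InAll u w y → InAll w z y)) →
      UDP G R α (AllV G) (AllE G)
    udp-pasting W hyp u w _ _ _ x x∈ with V₁∪V₂ u | V₁∪V₂ w
      where open Pasting W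
    ... | inj₁ u∈V₁ | inj₁ w∈V₁ =
      let (ρ , spline , difference , _) = udp-constantOnV₂ W u∈V₁ w∈V₁ x∈ in ρ , spline , difference
    ... | inj₂ u∈V₂ | inj₂ w∈V₂ =
      let (ρ , spline , difference , _) = udp-constantOnV₂ (swap W) u∈V₂ w∈V₂ x∈ in ρ , spline , difference
    ... | inj₁ u∈V₁ | inj₂ w∈V₂ = udp-across W u∈V₁ w∈V₂ (hyp u w) x∈
    ... | inj₂ u∈V₂ | inj₁ w∈V₁ = udp-across (swap W) u∈V₂ w∈V₁ (hyp u w) x∈

mainTheorem5 : ∀ {c ℓ} (R : CommutativeRing c ℓ) (G : Graph)
    (α : Fin (Graph.nE G) → Ideal R)
    (V₁ V₂ : Fin (Graph.nV G) → Set) (E₁ E₂ : Fin (Graph.nE G) → Set)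
    (z : Fin (Graph.nV G)) →
    V₁ z → V₂ z → (∀ v → V₁ v → V₂ v → v ≡ z) →
    (∀ v → V₁ v ⊎ V₂ v) →
    (∀ e → E₁ e → V₁ (Graph.src G e) × V₁ (Graph.tgt G e)) →
    (∀ e → E₂ e → V₂ (Graph.src G e) × V₂ (Graph.tgt G e)) →
    (∀ e → E₁ e ⊎ E₂ e) →
    Connected G V₁ E₁ → Connected G V₂ E₂ →
    UDP G R α V₁ E₁ → UDP G R α V₂ E₂ →
    (∀ u w →
      (∀ x → InAllPaths G R α (AllV G) (AllE G) u w x →
             InAllPaths G R α (AllV G) (AllE G) u z x)
      ⊎
      (∀ x → InAllPaths G R α (AllV G) (AllE G) u w x →
             InAllPaths G R α (AllV G) (AllE G) w z x)) →
    UDP G R α (AllV G) (AllE G)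
mainTheorem5 R G α V₁ V₂ E₁ E₂ z z∈V₁ z∈V₂ V₁∩V₂⊆z V₁∪V₂ E₁-ends E₂-ends E₁∪E₂
             connected₁ connected₂ udp₁ udp₂ =
  udp-pasting G R α record
    { V₁ = V₁ ; V₂ = V₂ ; E₁ = E₁ ; E₂ = E₂ ; z = z
    ; z∈V₁ = z∈V₁ ; z∈V₂ = z∈V₂ ; V₁∩V₂⊆z = V₁∩V₂⊆z ; V₁∪V₂ = V₁∪V₂
    ; E₁-ends = E₁-ends ; E₂-ends = E₂-ends ; E₁∪E₂ = E₁∪E₂
    ; connected₁ = connected₁ ; connected₂ = connected₂
    ; udp₁ = udp₁ ; udp₂ = udp₂
    }
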